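{- Let $d\ge 2$ and let $Z(d)$ be the $d$-polytope defined in the context. For $0\le k\le d-1$, the number $f_k(Z(d))$ of $k$-faces of $Z(d)$ is \[ f_k(Z(d))=\begin{cases} 2d-1, & k=0,\\ d^2+d-3=\zeta_1(2d-1,d)+1, & k=1,\\ \binom{d+1}{k+1}+\binom{d}{k+1}+\binom{d-1}{k}, & k\ge 2. \end{cases} \] In particular, $f_2(Z(d))=\zeta_2(2d-1,d)+1$ and $f_k(Z(d))=\zeta_k(2d-1,d)$ for $k\ge 3$.
   Context: Binomial coefficients $\binom{n}{j}$ are taken to be $0$ when $j<0$ or $j>n$. For integers $d$, $s$, $k$ define $\phi_k(d+s,d):=\binom{d+1}{k+1}+\binom{d}{k+1}-\binom{d+1-s}{k+1}$ and $\zeta_k(d+s,d):=\phi_k(d+s,d)+\binom{d-1}{k}-\binom{d+1-s}{k}$ (so $\zeta_k(2d-1,d)$ corresponds to $s=d-1$). Wedge: let $P$ be a $d$-polytope in the hyperplane $x_{d+1}=0$ of $\mathbb{R}^{d+1}$ and $F$ a proper face of $P$. Cut the half-cylinder $P\times[0,\infty)$ by a hyperplane through $F\times\{0\}$ that splits it into a bounded and an unbounded part; the bounded part is the wedge $\mathrm{wed}_F(P)$ (combinatorially, a prism over $P$ in which the face "prism over $F$" is collapsed onto $F$). $Z(d)$: $Z(3)$ is a triangular bipyramid and $Z(2)$ is a triangular 2-face of $Z(3)$; for $d\ge 4$, $Z(d)$ is the wedge of $Z(d-1)$ at a facet of $Z(d-1)$ which is the copy of $Z(d-2)$ from the construction.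 -}

module Defs where

open import Data.Nat using (ℕ; zero; suc; _+_; _≟_)
open import Data.Nat.Combinatorics using (_C_)
open import Data.Integer as ℤ using (ℤ; +_; -[1+_])
open import Data.Bool using (Bool; true; false)
open import Data.Vec using (Vec; []; _∷_; _++_)
open import Data.List using (List; []; _∷_; length; filter; concatMap)
open import Data.Product using (_×_; _,_; proj₂)
open import Data.Fin.Subset using (Subset; _∩_; ∁; ⊥; ⊤; inside; outside)
open import Data.Fin.Subset.Properties using (_⊆?_)
open import Relation.Nullary using (yes; no)

-- Binomial coefficients with integer arguments:  binom n j = 0 when
-- j < 0 or j > n (in particular whenever n < 0).

binom : ℤ → ℤ → ℤ
binom (+ n) (+ j) = + (n C j)
binom _     _     = + 0

-- φ_k(d+s,d) and ζ_k(d+s,d), written as functions of d, s, k.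
φ : ℤ → ℤ → ℤ → ℤ
φ d s k = binom (d ℤ.+ + 1) (k ℤ.+ + 1) ℤ.+ binom d (k ℤ.+ + 1)
          ℤ.- binom (d ℤ.+ + 1 ℤ.- s) (k ℤ.+ + 1)

ζ : ℤ → ℤ → ℤ → ℤ
ζ d s k = φ d s k ℤ.+ binom (d ℤ.- + 1) k ℤ.- binom (d ℤ.+ + 1 ℤ.- s) k

-- Combinatorial model of a polytope: a (possibly redundant) set of
-- vertex labels Fin nv, and the list of its NONEMPTY faces (including the
-- polytope itself), each given by its vertex set and its dimension.

record Poly : Set where
  field
    nv    : ℕ
    faces : List (Subset nv × ℕ)
open Poly public

fcount : Poly → ℕ → ℕ
fcount P k = length (filter (λ G → proj₂ G ≟ k) (faces P))

-- Wedge (combinatorially: prism over P with "prism over F" collapsed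
-- onto F).  Vertex labels of wed_F(P) are Fin (nv + nv): label v (left)
-- is the bottom copy (v,0), label nv+v (right) is the top copy (v,1);
-- for v ∈ F the two copies are identified and we use the left label.
-- Faces of wed_F(P): for each nonempty face G of P,
--   * if G ⊆ F : the face G itself (dim G);
--   * otherwise: G×{0} (dim G), G×{1} (dim G), G×[0,1] (dim G + 1).

wedFaces : ∀ {n} → Subset n → Subset n × ℕ → List (Subset (n + n) × ℕ)
wedFaces {n} F (G , k) with G ⊆? F
... | yes _ = (G ++ ⊥ , k) ∷ []
... | no  _ = (G ++ ⊥ , k)
            ∷ ((G ∩ F) ++ (G ∩ ∁ F) , k)
            ∷ (G ++ (G ∩ ∁ F) , suc k)
            ∷ []

wed : (P : Poly) → Subset (nv P) → Poly
wed P F = record { nv = nv P + nv P ; faces = concatMap (wedFaces F) (faces P) }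

bottomCopy : (P : Poly) → Subset (nv P + nv P)
bottomCopy P = ⊤ {nv P} ++ ⊥ {nv P}

triangle : Poly
triangle = record { nv = 3 ; faces =
    (s 1 0 0 , 0) ∷ (s 0 1 0 , 0) ∷ (s 0 0 1 , 0)
  ∷ (s 1 1 0 , 1) ∷ (s 0 1 1 , 1) ∷ (s 1 0 1 , 1)
  ∷ (s 1 1 1 , 2) ∷ [] }
  where
  b : ℕ → Bool
  b zero = false
  b (suc _) = true
  s : ℕ → ℕ → ℕ → Subset 3
  s x y z = b x ∷ b y ∷ b z ∷ []

-- Z(3): triangular bipyramid, equator vertices 0,1,2, apices 3,4.
bipyramid : Poly
bipyramid = record { nv = 5 ; faces =
    (s 1 0 0 0 0 , 0) ∷ (s 0 1 0 0 0 , 0) ∷ (s 0 0 1 0 0 , 0)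
  ∷ (s 0 0 0 1 0 , 0) ∷ (s 0 0 0 0 1 , 0)
  ∷ (s 1 1 0 0 0 , 1) ∷ (s 0 1 1 0 0 , 1) ∷ (s 1 0 1 0 0 , 1)
  ∷ (s 1 0 0 1 0 , 1) ∷ (s 0 1 0 1 0 , 1) ∷ (s 0 0 1 1 0 , 1)
  ∷ (s 1 0 0 0 1 , 1) ∷ (s 0 1 0 0 1 , 1) ∷ (s 0 0 1 0 1 , 1)
  ∷ (s 1 1 0 1 0 , 2) ∷ (s 0 1 1 1 0 , 2) ∷ (s 1 0 1 1 0 , 2)
  ∷ (s 1 1 0 0 1 , 2) ∷ (s 0 1 1 0 1 , 2) ∷ (s 1 0 1 0 1 , 2)
  ∷ (s 1 1 1 1 1 , 3) ∷ [] }
  where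
  b : ℕ → Bool
  b zero = false
  b (suc _) = true
  s : ℕ → ℕ → ℕ → ℕ → ℕ → Subset 5
  s x y z u v = b x ∷ b y ∷ b z ∷ b u ∷ b v ∷ []

-- A triangular 2-face of Z(3) (the copy of Z(2) used in the construction).
bipyramidTriangle : Subset 5
bipyramidTriangle = true ∷ true ∷ false ∷ true ∷ false ∷ []

-- ZF n = (Z(n+3), the facet of Z(n+3) that is the copy of Z(n+2)).
-- Z(d) = wed of Z(d-1) at the copy of Z(d-2); the copy of Z(d-1) in
-- Z(d) = wed(Z(d-1)) is its base P×{0}.
record PolyFace : Set where
  field
    poly  : Poly
    face  : Subset (nv poly)
open PolyFace public

ZF : ℕ → PolyFace
ZF zero    = record { poly = bipyramid ; face = bipyramidTriangle }
ZF (suc n) = record { poly = wed (poly (ZF n)) (face (ZF n))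
                    ; face = bottomCopy (poly (ZF n)) }

-- Z(d) for d ≥ 2 (Z 0, Z 1 are unused dummies).
Z : ℕ → Poly
Z zero = triangle
Z (suc zero) = triangle
Z (suc (suc zero)) = triangle
Z (suc (suc (suc n))) = poly (ZF n)

-- A face G of P gives the face G × 0 of wed_F P and, when G ⊈ F, also the top copy G × 1
-- and the prism G × [0,1] one dimension higher.  Writing o_k(P, F) for the number of
-- k-faces of P not contained in F, this gives
--   f_k(wed_F P) = f_k(P) + o_k(wed_F P, P × 0),
--   o_k(wed_F P, P × 0) = o_k(P, F) + o_{k-1}(P, F).
-- Along Z(d) = wed Z(d-1) at the copy of Z(d-2), the numbers o_k(Z(d), Z(d-1)) therefore
-- obey Pascal's recurrence in (d, k), so they equal C(d,k) + C(d-1,k) + C(d-2,k-1) as they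
-- do for the bipyramid Z(3); summing them over d (hockey stick) gives
-- f_k(Z(d)) = C(d+1,k+1) + C(d,k+1) + C(d-1,k) up to a correction in k = 0, 1 inherited
-- from Z(3).  Finally ζ_k(2d-1,d) is that same sum minus C(3,k+1).
module Submission where

open import Defs
open import Data.Nat using (ℕ; zero; suc; _+_; _*_; _∸_; _≤_; _<_; _≟_; s≤s; z≤n)
open import Data.Nat.Properties
  using (+-suc; suc-injective; +-identityʳ; +-cancelʳ-≡; +-∸-assoc; +-comm; +-commutativeSemigroup)
open import Algebra.Properties.CommutativeSemigroup +-commutativeSemigroup
  using (interchange; xy∙z≈xz∙y)
open import Data.Nat.Combinatorics using (_C_; nCk+nC[k+1]≡[n+1]C[k+1]; nC1≡n)
import Data.Nat.Tactic.RingSolver as ℕ-Solver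
open import Data.Integer as ℤ using (ℤ; +_)
import Data.Integer.Properties as ℤₚ
import Data.Integer.Tactic.RingSolver as ℤ-Solver
open import Data.List using (List; []; _∷_; _++_; length; filter; map; concatMap)
open import Data.List.Properties using (filter-accept; filter-reject; filter-none; filter-≐)
open import Data.List.Relation.Unary.All using (universal)
open import Data.Product using (_×_; _,_; proj₁; proj₂; map₁)
import Data.Product as Product
open import Data.Vec using ([]; _∷_; here; there) renaming (_++_ to _++ᵛ_)
open import Data.Fin.Subset using (Subset; _⊆_; _∩_; ∁; ⊥; ⊤)
open import Data.Fin.Subset.Properties
  using (_⊆?_; drop-∷-⊆; _∈?_; ∉⊥; x∈p∩q⁺; x∉p⇒x∈∁p)
open import Function using (_∘_)
open import Relation.Unary using (Pred; Decidable)
open import Relation.Nullary using (Dec; yes; no; ¬_; ¬?; contradiction)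
open import Relation.Binary.PropositionalEquality

private
  variable
    m n : ℕ

length-filter-split : ∀ {a p q} {A : Set a} {P : Pred A p} {Q : Pred A q}
                      (P? : Decidable P) (Q? : Decidable Q) (xs : List A) →
                      length (filter Q? xs) ≡
                      length (filter Q? (filter P? xs)) + length (filter Q? (filter (¬? ∘ P?) xs))
length-filter-split P? Q? [] = refl
length-filter-split P? Q? (x ∷ xs) with P? x
... | yes _ with Q? x
...   | yes _ = cong suc (length-filter-split P? Q? xs)
...   | no  _ = length-filter-split P? Q? xs
length-filter-split P? Q? (x ∷ xs) | no _ with Q? x
...   | yes _ = trans (cong suc (length-filter-split P? Q? xs)) (sym (+-suc _ _))
...   | no  _ = length-filter-split P? Q? xs

length-filter-map : ∀ {a b p} {A : Set a} {B : Set b} {P : Pred B p}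
                    (P? : Decidable P) (g : A → B) (xs : List A) →
                    length (filter P? (map g xs)) ≡ length (filter (P? ∘ g) xs)
length-filter-map P? g [] = refl
length-filter-map P? g (x ∷ xs) with P? (g x)
... | yes _ = cong suc (length-filter-map P? g xs)
... | no  _ = length-filter-map P? g xs

length-filter-concatMap-pair : ∀ {a b p} {A : Set a} {B : Set b} {P : Pred B p}
                               (P? : Decidable P) (f g : A → B) (xs : List A) →
                               length (filter P? (concatMap (λ x → f x ∷ g x ∷ []) xs)) ≡
                               length (filter P? (map f xs)) + length (filter P? (map g xs))
length-filter-concatMap-pair P? f g [] = refl
length-filter-concatMap-pair P? f g (x ∷ xs) with P? (f x)
... | yes _ with P? (g x)
...   | yes _ =
  cong suc (trans (cong suc (length-filter-concatMap-pair P? f g xs)) (sym (+-suc _ _)))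
...   | no  _ = cong suc (length-filter-concatMap-pair P? f g xs)
length-filter-concatMap-pair P? f g (x ∷ xs) | no _ with P? (g x)
...   | yes _ = trans (cong suc (length-filter-concatMap-pair P? f g xs)) (sym (+-suc _ _))
...   | no  _ = length-filter-concatMap-pair P? f g xs

shift : (ℕ → ℕ) → ℕ → ℕ
shift g zero    = 0
shift g (suc k) = g k

dimCount : List (Subset n × ℕ) → ℕ → ℕ
dimCount L k = length (filter (λ G → proj₂ G ≟ k) L)

inside outside : Subset n → List (Subset n × ℕ) → List (Subset n × ℕ)
inside  F = filter (λ G → proj₁ G ⊆? F)
outside F = filter (λ G → ¬? (proj₁ G ⊆? F))

dimCount-inside+outside : ∀ k (F : Subset n) L →
                          dimCount L k ≡ dimCount (inside F L) k + dimCount (outside F L) k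
dimCount-inside+outside k F = length-filter-split (λ G → proj₁ G ⊆? F) (λ G → proj₂ G ≟ k)

dimCount-map₁ : ∀ (f : Subset m → Subset n) L k → dimCount (map (map₁ f) L) k ≡ dimCount L k
dimCount-map₁ f L k = length-filter-map _ (map₁ f) L

dimCount-map-suc : ∀ (f : Subset m → Subset n) L k →
                   dimCount (map (Product.map f suc) L) k ≡ shift (dimCount L) k
dimCount-map-suc f L zero    = trans (length-filter-map _ (Product.map f suc) L)
                                     (cong length (filter-none _ (universal (λ _ ()) L)))
dimCount-map-suc f L (suc k) = trans (length-filter-map _ (Product.map f suc) L)
                                     (cong length (filter-≐ _ _ (suc-injective , cong suc) L))

⊆-⊤-++ : ∀ (p : Subset m) {r : Subset n} → p ++ᵛ r ⊆ ⊤ ++ᵛ r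
⊆-⊤-++ []      x∈r        = x∈r
⊆-⊤-++ (_ ∷ p) here       = here
⊆-⊤-++ (_ ∷ p) (there x∈) = there (⊆-⊤-++ p x∈)

++-⊆-dropˡ : ∀ (p q : Subset m) {r s : Subset n} → p ++ᵛ r ⊆ q ++ᵛ s → r ⊆ s
++-⊆-dropˡ []      []      r⊆s = r⊆s
++-⊆-dropˡ (_ ∷ p) (_ ∷ q) p⊆q = ++-⊆-dropˡ p q (drop-∷-⊆ p⊆q)

p∩∁q⊆⊥⇒p⊆q : ∀ (p q : Subset n) → p ∩ ∁ q ⊆ ⊥ → p ⊆ q
p∩∁q⊆⊥⇒p⊆q p q p∩∁q⊆⊥ {x} x∈p with x ∈? q
... | yes x∈q = x∈q
... | no  x∉q = contradiction (p∩∁q⊆⊥ (x∈p∩q⁺ (x∈p , x∉p⇒x∈∁p x∉q))) ∉⊥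

topFace prismFace : Subset m → Subset m × ℕ → Subset (m + m) × ℕ
topFace   F (G , j) = ((G ∩ F) ++ᵛ (G ∩ ∁ F) , j)
prismFace F (G , j) = (G ++ᵛ (G ∩ ∁ F) , suc j)

sideFaces : Subset m → Subset m × ℕ → List (Subset (m + m) × ℕ)
sideFaces F G = topFace F G ∷ prismFace F G ∷ []

module _ (F : Subset m) where

  private
    bottom : Subset (m + m)
    bottom = ⊤ {m} ++ᵛ ⊥ {m}

    _⊆bottom? : (H : Subset (m + m) × ℕ) → Dec (proj₁ H ⊆ bottom)
    H ⊆bottom? = proj₁ H ⊆? bottom

    wedge : List (Subset m × ℕ) → List (Subset (m + m) × ℕ)
    wedge = concatMap (wedFaces F)

    side⊈bottom : ∀ {G} → ¬ G ⊆ F → ∀ (q : Subset m) → ¬ q ++ᵛ (G ∩ ∁ F) ⊆ bottom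
    side⊈bottom {G} G⊈F q side⊆bottom = G⊈F (p∩∁q⊆⊥⇒p⊆q G F (++-⊆-dropˡ q ⊤ side⊆bottom))

  inside-bottom-wedge : ∀ L → inside bottom (wedge L) ≡ map (map₁ (_++ᵛ ⊥ {m})) L
  inside-bottom-wedge [] = refl
  inside-bottom-wedge ((G , j) ∷ L) with G ⊆? F
  ... | yes _ = trans (filter-accept _⊆bottom? (⊆-⊤-++ G)) (cong (_ ∷_) (inside-bottom-wedge L))
  ... | no G⊈F = trans (filter-accept _⊆bottom? (⊆-⊤-++ G)) (cong (_ ∷_) (begin
    filter _⊆bottom? (topFace F (G , j) ∷ prismFace F (G , j) ∷ wedge L)
      ≡⟨ filter-reject _⊆bottom? (side⊈bottom G⊈F (G ∩ F)) ⟩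
    filter _⊆bottom? (prismFace F (G , j) ∷ wedge L)
      ≡⟨ filter-reject _⊆bottom? (side⊈bottom G⊈F G) ⟩
    filter _⊆bottom? (wedge L)
      ≡⟨ inside-bottom-wedge L ⟩
    map (map₁ (_++ᵛ ⊥)) L ∎))
    where open ≡-Reasoning

  outside-bottom-wedge : ∀ L → outside bottom (wedge L) ≡ concatMap (sideFaces F) (outside F L)
  outside-bottom-wedge [] = refl
  outside-bottom-wedge ((G , j) ∷ L) with G ⊆? F
  ... | yes _ = trans (filter-reject (¬? ∘ _⊆bottom?) (λ G⊈bottom → G⊈bottom (⊆-⊤-++ G)))
                      (outside-bottom-wedge L)
  ... | no G⊈F = begin
    filter P? ((G ++ᵛ ⊥ , j) ∷ topFace F (G , j) ∷ prismFace F (G , j) ∷ wedge L)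
      ≡⟨ filter-reject P? (λ G⊈bottom → G⊈bottom (⊆-⊤-++ G)) ⟩
    filter P? (topFace F (G , j) ∷ prismFace F (G , j) ∷ wedge L)
      ≡⟨ filter-accept P? (side⊈bottom G⊈F (G ∩ F)) ⟩
    topFace F (G , j) ∷ filter P? (prismFace F (G , j) ∷ wedge L)
      ≡⟨ cong (_ ∷_) (filter-accept P? (side⊈bottom G⊈F G)) ⟩
    topFace F (G , j) ∷ prismFace F (G , j) ∷ filter P? (wedge L)
      ≡⟨ cong (λ L′ → _ ∷ _ ∷ L′) (outside-bottom-wedge L) ⟩
    sideFaces F (G , j) ++ concatMap (sideFaces F) (outside F L) ∎
    where open ≡-Reasoning
          P? = ¬? ∘ _⊆bottom?

fcountOutside : (P : Poly) → Subset (nv P) → ℕ → ℕ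
fcountOutside P F = dimCount (outside F (faces P))

module _ (P : Poly) (F : Subset (nv P)) where

  fcount-wed : ∀ k → fcount (wed P F) k ≡ fcount P k + fcountOutside (wed P F) (bottomCopy P) k
  fcount-wed k = begin
    fcount (wed P F) k
      ≡⟨ dimCount-inside+outside k (bottomCopy P) (faces (wed P F)) ⟩
    dimCount (inside (bottomCopy P) (faces (wed P F))) k + o
      ≡⟨ cong (λ L → dimCount L k + o) (inside-bottom-wedge F (faces P)) ⟩
    dimCount (map (map₁ (_++ᵛ ⊥)) (faces P)) k + o
      ≡⟨ cong (_+ o) (dimCount-map₁ (_++ᵛ ⊥) (faces P) k) ⟩
    fcount P k + o ∎
    where open ≡-Reasoning
          o = fcountOutside (wed P F) (bottomCopy P) k

  fcountOutside-wed : ∀ k → fcountOutside (wed P F) (bottomCopy P) k ≡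
                            fcountOutside P F k + shift (fcountOutside P F) k
  fcountOutside-wed k = begin
    fcountOutside (wed P F) (bottomCopy P) k
      ≡⟨ cong (λ L → dimCount L k) (outside-bottom-wedge F (faces P)) ⟩
    dimCount (concatMap (sideFaces F) O) k
      ≡⟨ length-filter-concatMap-pair _ (topFace F) (prismFace F) O ⟩
    dimCount (map (topFace F) O) k + dimCount (map (prismFace F) O) k
      ≡⟨ cong₂ _+_ (dimCount-map₁ (λ G → (G ∩ F) ++ᵛ (G ∩ ∁ F)) O k)
                   (dimCount-map-suc (λ G → G ++ᵛ (G ∩ ∁ F)) O k) ⟩
    dimCount O k + shift (dimCount O) k ∎
    where open ≡-Reasoning
          O = outside F (faces P)

PascalRecurrent : (ℕ → ℕ → ℕ) → Set
PascalRecurrent a = ∀ n k → a (suc n) k ≡ a n k + shift (a n) k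

shift-cong : ∀ {g h : ℕ → ℕ} → (∀ k → g k ≡ h k) → ∀ k → shift g k ≡ shift h k
shift-cong g≗h zero    = refl
shift-cong g≗h (suc k) = g≗h k

shift-pascal : ∀ {a} → PascalRecurrent a → PascalRecurrent (λ n → shift (a n))
shift-pascal ra n zero    = refl
shift-pascal ra n (suc k) = ra n k

binomial-pascal : ∀ c → PascalRecurrent (λ n k → (c + n) C k)
binomial-pascal c n zero    = refl
binomial-pascal c n (suc k) rewrite +-suc c n =
  trans (sym (nCk+nC[k+1]≡[n+1]C[k+1] (c + n) k)) (+-comm ((c + n) C k) _)

module _ {a b : ℕ → ℕ → ℕ} where

  +-pascal : PascalRecurrent a → PascalRecurrent b → PascalRecurrent (λ n k → a n k + b n k)
  +-pascal ra rb n zero    =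
    trans (cong₂ _+_ (ra n 0) (rb n 0)) (interchange (a n 0) 0 (b n 0) 0)
  +-pascal ra rb n (suc k) =
    trans (cong₂ _+_ (ra n (suc k)) (rb n (suc k))) (interchange (a n (suc k)) _ _ _)

  pascal-unique : PascalRecurrent a → PascalRecurrent b → (∀ k → a 0 k ≡ b 0 k) →
                  ∀ n k → a n k ≡ b n k
  pascal-unique ra rb a₀≗b₀ zero    k = a₀≗b₀ k
  pascal-unique ra rb a₀≗b₀ (suc n) k = begin
    a (suc n) k            ≡⟨ ra n k ⟩
    a n k + shift (a n) k  ≡⟨ cong₂ _+_ (aₙ≗bₙ k) (shift-cong aₙ≗bₙ k) ⟩
    b n k + shift (b n) k  ≡⟨ rb n k ⟨
    b (suc n) k            ∎
    where open ≡-Reasoning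
          aₙ≗bₙ = pascal-unique ra rb a₀≗b₀ n

  pascal-partial-sums : ∀ (c : ℕ → ℕ) → PascalRecurrent b →
                        (∀ n k → a (suc n) k ≡ a n k + b (suc n) k) →
                        (∀ k → a 0 k + c k ≡ b 1 (suc k)) →
                        ∀ n k → a n k + c k ≡ b (suc n) (suc k)
  pascal-partial-sums c rb step base zero    k = base k
  pascal-partial-sums c rb step base (suc n) k = begin
    a (suc n) k + c k                ≡⟨ cong (_+ c k) (step n k) ⟩
    a n k + b (suc n) k + c k        ≡⟨ xy∙z≈xz∙y (a n k) _ _ ⟩
    a n k + c k + b (suc n) k        ≡⟨ cong (_+ b (suc n) k) ih ⟩
    b (suc n) (suc k) + b (suc n) k  ≡⟨ rb (suc n) (suc k) ⟨
    b (suc (suc n)) (suc k)          ∎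
    where open ≡-Reasoning
          ih = pascal-partial-sums c rb step base n k

[n+1]C2+nC2≡n*n : ∀ n → suc n C 2 + n C 2 ≡ n * n
[n+1]C2+nC2≡n*n zero    = refl
[n+1]C2+nC2≡n*n (suc n) = begin
  suc (suc n) C 2 + suc n C 2               ≡⟨ cong₂ _+_ (binomial-pascal 0 (suc n) 2)
                                                         (binomial-pascal 0 n 2) ⟩
  (suc n C 2 + suc n C 1) + (n C 2 + n C 1) ≡⟨ interchange (suc n C 2) _ _ _ ⟩
  (suc n C 2 + n C 2) + (suc n C 1 + n C 1) ≡⟨ cong₂ _+_ ([n+1]C2+nC2≡n*n n)
                                                         (cong₂ _+_ (nC1≡n (suc n)) (nC1≡n n)) ⟩
  n * n + (suc n + n)                       ≡⟨ square-suc n ⟩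
  suc n * suc n                             ∎
  where
  open ≡-Reasoning
  square-suc : ∀ n → n * n + (suc n + n) ≡ suc n * suc n
  square-suc = ℕ-Solver.solve-∀

-- With s = d - 1 we get d + 1 - s = 2, and the two subtracted binomials C(2,k+1) + C(2,k)
-- add up to C(3,k+1).
ζ-2d-1 : ∀ m k → ζ (+ suc m) (+ suc m ℤ.- + 1) (+ k) ℤ.+ + (3 C suc k) ≡
                 + (suc (suc m) C suc k + suc m C suc k + m C k)
ζ-2d-1 m k = begin
  ζ d (d ℤ.- + 1) (+ k) ℤ.+ + (3 C suc k)
    ≡⟨ cong (λ t → ζ′ t ℤ.+ + (3 C suc k)) (d+1-[d-1]≡2 d) ⟩
  ζ′ (+ 2) ℤ.+ + (3 C suc k)
    ≡⟨ cong₂ (λ p q → ζ″ p q ℤ.+ + (3 C suc k)) (cong suc (+-comm m 1)) (+-comm k 1) ⟩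
  ζ″ (suc (suc m)) (suc k) ℤ.+ + (3 C suc k)
    ≡⟨ cong (λ t → ζ″ (suc (suc m)) (suc k) ℤ.+ + t) (sym (nCk+nC[k+1]≡[n+1]C[k+1] 2 k)) ⟩
  ζ″ (suc (suc m)) (suc k) ℤ.+ (+ (2 C k) ℤ.+ + (2 C suc k))
    ≡⟨ cancel (+ A) (+ B) (+ (m C k)) (+ (2 C suc k)) (+ (2 C k)) ⟩
  + (A + B + m C k) ∎
  where
  open ≡-Reasoning
  d = + suc m
  A = suc (suc m) C suc k
  B = suc m C suc k
  ζ′ : ℤ → ℤ
  ζ′ t = binom (d ℤ.+ + 1) (+ k ℤ.+ + 1) ℤ.+ binom d (+ k ℤ.+ + 1) ℤ.- binom t (+ k ℤ.+ + 1)
         ℤ.+ binom (d ℤ.- + 1) (+ k) ℤ.- binom t (+ k)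
  ζ″ : ℕ → ℕ → ℤ
  ζ″ p q = + (p C q) ℤ.+ + (suc m C q) ℤ.- + (2 C q) ℤ.+ + (m C k) ℤ.- + (2 C k)
  d+1-[d-1]≡2 : ∀ (x : ℤ) → x ℤ.+ + 1 ℤ.- (x ℤ.- + 1) ≡ + 2
  d+1-[d-1]≡2 = ℤ-Solver.solve-∀
  cancel : ∀ (a b c x y : ℤ) → (a ℤ.+ b ℤ.- x ℤ.+ c ℤ.- y) ℤ.+ (y ℤ.+ x) ≡ a ℤ.+ b ℤ.+ c
  cancel = ℤ-Solver.solve-∀

z+[a+b]≡c+b⇒c≡z+a : ∀ (z : ℤ) a b c → z ℤ.+ + (a + b) ≡ + (c + b) → + c ≡ z ℤ.+ + a
z+[a+b]≡c+b⇒c≡z+a z a b c eq = begin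
  + c                          ≡⟨ add-sub (+ c) (+ b) ⟩
  + (c + b) ℤ.- + b            ≡⟨ cong (ℤ._- + b) eq ⟨
  z ℤ.+ (+ a ℤ.+ + b) ℤ.- + b  ≡⟨ add-sub′ z (+ a) (+ b) ⟩
  z ℤ.+ + a                    ∎
  where
  open ≡-Reasoning
  add-sub : ∀ (x y : ℤ) → x ≡ x ℤ.+ y ℤ.- y
  add-sub = ℤ-Solver.solve-∀
  add-sub′ : ∀ (x y w : ℤ) → x ℤ.+ (y ℤ.+ w) ℤ.- w ≡ x ℤ.+ y
  add-sub′ = ℤ-Solver.solve-∀

fcountOutsideZ : ℕ → ℕ → ℕ
fcountOutsideZ n = fcountOutside (poly (ZF n)) (face (ZF n))

fcountOutsideZ-pascal : PascalRecurrent fcountOutsideZ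
fcountOutsideZ-pascal n = fcountOutside-wed (poly (ZF n)) (face (ZF n))

fcountOutsideZ-closed : ∀ n k →
                        fcountOutsideZ n k ≡ (3 + n) C k + (2 + n) C k + shift ((1 + n) C_) k
fcountOutsideZ-closed = pascal-unique fcountOutsideZ-pascal
  (+-pascal (+-pascal (binomial-pascal 3) (binomial-pascal 2)) (shift-pascal (binomial-pascal 1)))
  bipyramid-outside-triangle
  where
  bipyramid-outside-triangle : ∀ k → fcountOutsideZ 0 k ≡ 3 C k + 2 C k + shift (1 C_) k
  bipyramid-outside-triangle 0 = refl
  bipyramid-outside-triangle 1 = refl
  bipyramid-outside-triangle 2 = refl
  bipyramid-outside-triangle 3 = refl
  bipyramid-outside-triangle (suc (suc (suc (suc k)))) = refl

-- How far the bipyramid Z(3), with f-vector (5, 9, 6, 1), falls short of the closed form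
-- (8, 11, 6, 1); the wedge recursion carries this offset along unchanged.
defect : ℕ → ℕ
defect 0 = 3
defect 1 = 2
defect _ = 0

fcount-Z : ∀ n k →
           fcount (Z (3 + n)) k + defect k ≡ (4 + n) C suc k + (3 + n) C suc k + (2 + n) C k
fcount-Z n k = trans
  (pascal-partial-sums defect fcountOutsideZ-pascal
    (λ n → fcount-wed (poly (ZF n)) (face (ZF n)))
    (λ k → trans (bipyramid-fcount k) (sym (fcountOutsideZ-closed 1 (suc k))))
    n k)
  (fcountOutsideZ-closed (suc n) (suc k))
  where
  bipyramid-fcount : ∀ k → fcount (Z 3) k + defect k ≡ 4 C suc k + 3 C suc k + 2 C k
  bipyramid-fcount 0 = refl
  bipyramid-fcount 1 = refl
  bipyramid-fcount 2 = refl
  bipyramid-fcount 3 = refl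
  bipyramid-fcount (suc (suc (suc (suc k)))) = refl

fcount-Z-vertices : ∀ n → fcount (Z (3 + n)) 0 ≡ 2 * (3 + n) ∸ 1
fcount-Z-vertices n = +-cancelʳ-≡ 3 _ _ (begin
  fcount (Z (3 + n)) 0 + 3       ≡⟨ fcount-Z n 0 ⟩
  (4 + n) C 1 + (3 + n) C 1 + 1  ≡⟨ cong₂ (λ x y → x + y + 1) (nC1≡n (4 + n)) (nC1≡n (3 + n)) ⟩
  (4 + n) + (3 + n) + 1          ≡⟨ rearrange n ⟩
  2 * (3 + n) ∸ 1 + 3            ∎)
  where
  open ≡-Reasoning
  rearrange : ∀ n → (4 + n) + (3 + n) + 1 ≡ (2 + n + (3 + n + 0)) + 3
  rearrange = ℕ-Solver.solve-∀

fcount-Z-edges : ∀ n → fcount (Z (3 + n)) 1 ≡ (3 + n) * (3 + n) + (3 + n) ∸ 3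
fcount-Z-edges n = trans (+-cancelʳ-≡ 2 _ _ (begin
  fcount (Z (3 + n)) 1 + 2                 ≡⟨ fcount-Z n 1 ⟩
  (4 + n) C 2 + (3 + n) C 2 + (2 + n) C 1  ≡⟨ cong₂ _+_ ([n+1]C2+nC2≡n*n (3 + n)) (nC1≡n (2 + n)) ⟩
  (3 + n) * (3 + n) + (2 + n)              ≡⟨ rearrange n ⟩
  (3 + n) * (3 + n) + n + 2                ∎))
  (sym (+-∸-assoc ((3 + n) * (3 + n)) (s≤s (s≤s (s≤s z≤n)))))
  where
  open ≡-Reasoning
  rearrange : ∀ n → (3 + n) * (3 + n) + (2 + n) ≡ (3 + n) * (3 + n) + n + 2
  rearrange = ℕ-Solver.solve-∀

fcount-Z-ζ : ∀ n k → ζ (+ (3 + n)) (+ (3 + n) ℤ.- + 1) (+ k) ℤ.+ + (3 C suc k) ≡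
                     + (fcount (Z (3 + n)) k + defect k)
fcount-Z-ζ n k = trans (ζ-2d-1 (2 + n) k) (cong +_ (sym (fcount-Z n k)))

lemma2p8 : (d : ℕ) → 2 ≤ d →
    (fcount (Z d) 0 ≡ 2 * d ∸ 1)
    × (fcount (Z d) 1 ≡ d * d + d ∸ 3)
    × (+ fcount (Z d) 1 ≡ ζ (+ d) (+ d ℤ.- + 1) (+ 1) ℤ.+ + 1)
    × (∀ k → 2 ≤ k → k < d →
         fcount (Z d) k ≡ suc d C suc k + d C suc k + (d ∸ 1) C k)
    × (2 < d → + fcount (Z d) 2 ≡ ζ (+ d) (+ d ℤ.- + 1) (+ 2) ℤ.+ + 1)
    × (∀ k → 3 ≤ k → k < d → + fcount (Z d) k ≡ ζ (+ d) (+ d ℤ.- + 1) (+ k))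
lemma2p8 (suc zero) (s≤s ())
lemma2p8 (suc (suc zero)) _ =
  refl , refl , refl ,
  (λ { _ (s≤s (s≤s _)) (s≤s (s≤s ())) }) ,
  (λ { (s≤s (s≤s ())) }) ,
  (λ { _ (s≤s (s≤s (s≤s _))) (s≤s (s≤s ())) })
lemma2p8 (suc (suc (suc n))) _ =
  fcount-Z-vertices n ,
  fcount-Z-edges n ,
  z+[a+b]≡c+b⇒c≡z+a (ζ₃₊ₙ 1) 1 2 _ (fcount-Z-ζ n 1) ,
  (λ { (suc (suc k)) (s≤s (s≤s _)) _ → trans (sym (+-identityʳ _)) (fcount-Z n (2 + k)) }) ,
  (λ _ → z+[a+b]≡c+b⇒c≡z+a (ζ₃₊ₙ 2) 1 0 _ (fcount-Z-ζ n 2)) ,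
  (λ { (suc (suc (suc k))) (s≤s (s≤s (s≤s _))) _ →
         trans (z+[a+b]≡c+b⇒c≡z+a (ζ₃₊ₙ (3 + k)) 0 0 _ (fcount-Z-ζ n (3 + k))) (ℤₚ.+-identityʳ _) })
  where
  ζ₃₊ₙ : ℕ → ℤ
  ζ₃₊ₙ k = ζ (+ (3 + n)) (+ (3 + n) ℤ.- + 1) (+ k)
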